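{- Let $\mathbb{S}=(D,I,R)$ and $\mathbb{S}'=(D',I',R')$ be right string data structures over $[n]$ whose products $\star_I$ and $\star_{I'}$ are associative, and let $f:D\to D'$ be a morphism of string data structures from $\mathbb{S}$ to $\mathbb{S}'$. Then $f$ is a monoid homomorphism from the structure monoid $\mathbf{M}(\mathbb{S})=(D,\star_I)$ to the structure monoid $\mathbf{M}(\mathbb{S}')=(D',\star_{I'})$; that is, $f(\emptyset)=\emptyset'$ and $f(d\star_I d')=f(d)\star_{I'}f(d')$ for all $d,d'\in D$.
   Context: Fix $n\geq 1$ and the totally ordered alphabet $[n]=\{1<\dots<n\}$; $[n]^\ast$ is the free monoid on $[n]$ with empty word $\lambda$. For a nonempty word $u$, $\ell(u)$ denotes its leftmost letter and $\mathrm{rem}(u)$ the word with $u=\ell(u)\mathrm{rem}(u)$. A right string data structure $\mathbb{S}=(D,I,R)$ over $[n]$ consists of a set $D$ with a distinguished element $\emptyset$, a map $R:D\to[n]^\ast$ (reading) and a map $I:D\times[n]\to D$ (insertion) such that: (i) $R(I(\emptyset,x))=x$ for all $x\in[n]$; (ii) $\emptyset\leftarrow_I R(d)=d$ for all $d\in D$, where $\leftarrow_I:D\times[n]^\ast\to D$ is defined by $d\leftarrow_I\lambda=d$ and $d\leftarrow_I u=I(d,\ell(u))\leftarrow_I\mathrm{rem}(u)$ for nonempty $u$; (iii) $R$ is injective and $R(\emptyset)=\lambda$. The constructor is $C_{\mathbb{S}}:[n]^\ast\to D$, $w\mapsto \emptyset\leftarrow_I w$. The product on $D$ is $d\star_I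 d'=d\leftarrow_I R(d')$; when it is associative, $(D,\star_I)$ is a monoid with unit $\emptyset$, called the structure monoid $\mathbf{M}(\mathbb{S})$. A morphism of string data structures from $\mathbb{S}=(D,I,R)$ to $\mathbb{S}'=(D',I',R')$ (with distinguished elements $\emptyset,\emptyset'$) is a map $f:D\to D'$ with $f(\emptyset)=\emptyset'$ such that (a) $f(d\leftarrow_I x)=f(d)\leftarrow_{I'}x$ for all $d\in D$, $x\in[n]$, and (b) $C_{\mathbb{S}'}(R(d))=C_{\mathbb{S}'}(R'(f(d)))$ for all $d\in D$. -}

module Defs where

open import Data.Nat using (ℕ)
open import Data.Fin using (Fin)
open import Data.List using (List; []; _∷_; [_])
open import Relation.Binary.PropositionalEquality using (_≡_)
open import Function.Definitions using (Injective)

Word : ℕ → Set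
Word n = List (Fin n)

insertWord : ∀ {n} {D : Set} → (D → Fin n → D) → D → Word n → D
insertWord I d []      = d
insertWord I d (x ∷ u) = insertWord I (I d x) u

record StringDS (n : ℕ) : Set₁ where
  field
    D    : Set
    ∅    : D
    I    : D → Fin n → D
    R    : D → Word n
    read-insert-∅ : ∀ (x : Fin n) → R (I ∅ x) ≡ [ x ]
    insert-read   : ∀ (d : D) → insertWord I ∅ (R d) ≡ d
    R-injective   : Injective _≡_ _≡_ R
    R-∅           : R ∅ ≡ []

  _←_ : D → Word n → D
  _←_ = insertWord I

  C : Word n → D
  C w = ∅ ← w

  _⋆_ : D → D → D
  d ⋆ d' = d ← R d'

  IsAssociative : Set
  IsAssociative = ∀ a b c → (a ⋆ b) ⋆ c ≡ a ⋆ (b ⋆ c)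

record IsSDSMorphism {n : ℕ} (S S' : StringDS n)
                     (f : StringDS.D S → StringDS.D S') : Set where
  private
    module S  = StringDS S
    module S' = StringDS S'
  field
    pres-∅      : f S.∅ ≡ S'.∅
    pres-insert : ∀ (d : S.D) (x : Fin n) → f (S.I d x) ≡ S'.I (f d) x
    pres-C      : ∀ (d : S.D) → S'.C (S.R d) ≡ S'.C (S'.R (f d))

-- In an associative structure monoid, inserting a word w into d is the same as
-- multiplying d by the element C w built from w.  A morphism commutes with
-- insertion of words, so f (d ⋆ d') = f d ← R d' = f d ⋆' C' (R d'), and the
-- morphism axiom on constructors identifies C' (R d') with C' (R' (f d')) = f d'.
module Submission where

open import Defs
open import Data.Nat using (ℕ)
open import Data.List using ([]; _∷_; [_])
open import Data.Product using (_×_; _,_)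
open import Relation.Binary.PropositionalEquality hiding ([_])
open ≡-Reasoning

module _ {n : ℕ} (S : StringDS n) where
  open StringDS S

  I≡⋆C : ∀ d x → I d x ≡ d ⋆ C [ x ]
  I≡⋆C d x = cong (d ←_) (sym (read-insert-∅ x))

  ⋆-identityʳ : ∀ d → d ⋆ ∅ ≡ d
  ⋆-identityʳ d = cong (d ←_) R-∅

  -- Induction on w for all d at once; C [ x ] ← w and C (x ∷ w) are definitionally equal.
  ←≡⋆C : IsAssociative → ∀ d w → d ← w ≡ d ⋆ C w
  ←≡⋆C assoc d []      = sym (⋆-identityʳ d)
  ←≡⋆C assoc d (x ∷ w) = begin
    I d x ← w                ≡⟨ ←≡⋆C assoc (I d x) w ⟩
    I d x ⋆ C w              ≡⟨ cong (_⋆ C w) (I≡⋆C d x) ⟩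
    (d ⋆ C [ x ]) ⋆ C w      ≡⟨ assoc d (C [ x ]) (C w) ⟩
    d ⋆ (C [ x ] ⋆ C w)      ≡⟨ cong (d ⋆_) (sym (←≡⋆C assoc (C [ x ]) w)) ⟩
    d ⋆ C (x ∷ w)            ∎

module _ {n : ℕ} {S S' : StringDS n} {f : StringDS.D S → StringDS.D S'}
         (isMorphism : IsSDSMorphism S S' f) where
  private
    module S  = StringDS S
    module S' = StringDS S'
  open IsSDSMorphism isMorphism

  pres-← : ∀ d w → f (d S.← w) ≡ f d S'.← w
  pres-← d []      = refl
  pres-← d (x ∷ w) = trans (pres-← (S.I d x) w) (cong (S'._← w) (pres-insert d x))

  C'∘R≗f : ∀ d → S'.C (S.R d) ≡ f d
  C'∘R≗f d = trans (pres-C d) (S'.insert-read (f d))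

lemma2p1p3 : ∀ {n : ℕ} (S S' : StringDS n)
             → StringDS.IsAssociative S
             → StringDS.IsAssociative S'
             → (f : StringDS.D S → StringDS.D S')
             → IsSDSMorphism S S' f
             → (f (StringDS.∅ S) ≡ StringDS.∅ S')
               × (∀ (d d' : StringDS.D S)
                  → f (StringDS._⋆_ S d d') ≡ StringDS._⋆_ S' (f d) (f d'))
lemma2p1p3 S S' _ assoc' f isMorphism = IsSDSMorphism.pres-∅ isMorphism , pres-⋆
  where
  module S  = StringDS S
  module S' = StringDS S'

  pres-⋆ : ∀ d d' → f (d S.⋆ d') ≡ f d S'.⋆ f d'
  pres-⋆ d d' = begin
    f (d S.← S.R d')           ≡⟨ pres-← isMorphism d (S.R d') ⟩
    f d S'.← S.R d'            ≡⟨ ←≡⋆C S' assoc' (f d) (S.R d') ⟩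
    f d S'.⋆ S'.C (S.R d')     ≡⟨ cong (f d S'.⋆_) (C'∘R≗f isMorphism d') ⟩
    f d S'.⋆ f d'              ∎
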